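{- There exists an infinite quasiregular --- indeed it is also weakly regular --- conflicted semitopology $(\mathsf P,\mathsf{Opens})$. In more detail: \begin{itemize} \item every $p\in\mathsf P$ is weakly regular (so $p\in K(p)\in\mathsf{Opens}$) yet \item every $p\in\mathsf P$ is conflicted (so intertwinedness is not transitive at $p$). \end{itemize} Furthermore: $\mathsf P$ is a topology and contains no topen sets.
   Context: A semitopology is a pair $(\mathsf P,\mathsf{Opens})$ with $\mathsf{Opens}\subseteq\mathcal P(\mathsf P)$ containing $\varnothing$ and $\mathsf P$ and closed under arbitrary unions. Points $p,p'$ are intertwined when every open neighbourhood of $p$ intersects every open neighbourhood of $p'$; $p_{\between}$ denotes the set of points intertwined with $p$. $\mathrm{interior}(X)$ is the union of open sets contained in $X$. The community of $p$ is $K(p)=\mathrm{interior}(p_{\between})$; $p$ is quasiregular when $K(p)\neq\varnothing$ and weakly regular when $p\in K(p)$. $p$ is conflicted when there exist $p',p''$ with $p'$ intertwined with $p$ and $p$ intertwined with $p''$ but $p'$ not intertwined with $p''$. A set $T$ is topen when it is nonempty, open and transitive (for all open $O,O'$, if $O\cap T\neq\varnothing$ and $T\cap O'\neq\varnothing$ then $O\cap O'\neq\varnothing$). -}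

module Defs where

open import Level using (Level; 0ℓ) renaming (suc to lsuc)
open import Data.Empty using (⊥)
open import Data.Unit using (⊤)
open import Data.Product using (Σ; Σ-syntax; ∃; ∃-syntax; _×_; _,_)
open import Relation.Nullary using (¬_)

Subset : Set → Set₁
Subset P = P → Set

_⊆_ : {a b : Level} {P : Set} → (P → Set a) → (P → Set b) → Set (a Level.⊔ b)
X ⊆ Y = ∀ {p} → X p → Y p

record Semitopology (P : Set) : Set₁ where
  field
    Open      : Subset P → Set
    open-∅    : Open (λ _ → ⊥)
    open-full : Open (λ _ → ⊤)
    open-⋃    : (I : Set) (O : I → Subset P) → (∀ i → Open (O i))
                → Open (λ p → Σ I (λ i → O i p))

module _ {P : Set} (S : Semitopology P) where
  open Semitopology S

  Meets : Subset P → Subset P → Set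
  Meets O O' = ∃[ x ] (O x × O' x)

  Intertwined : P → P → Set₁
  Intertwined p p' = ∀ O O' → Open O → Open O' → O p → O' p' → Meets O O'

  intertwinedSet : P → (P → Set₁)
  intertwinedSet p = λ q → Intertwined p q

  interior : (P → Set₁) → (P → Set₁)
  interior X p = ∃[ O ] (Open O × O ⊆ X × O p)

  K : P → (P → Set₁)
  K p = interior (intertwinedSet p)

  Quasiregular : P → Set₁
  Quasiregular p = ∃[ q ] K p q

  WeaklyRegular : P → Set₁
  WeaklyRegular p = K p p

  Conflicted : P → Set₁
  Conflicted p = ∃[ p' ] ∃[ p'' ]
    (Intertwined p' p × Intertwined p p'' × ¬ Intertwined p' p'')

  Transitive : Subset P → Set₁
  Transitive T = ∀ O O' → Open O → Open O' → Meets O T → Meets T O' → Meets O O'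

  Topen : Subset P → Set₁
  Topen T = (∃[ p ] T p) × Open T × Transitive T

  IsTopology : Set₁
  IsTopology = ∀ O O' → Open O → Open O' → Open (λ p → O p × O' p)

-- Take finite binary words, ordered by "q extends p" (p is a suffix of q), with the up-closed
-- sets as opens. Comparable words are intertwined, so the up-set of p is an open neighbourhood
-- of p inside p's intertwined set and p is weakly regular. But p extends to false ∷ p and
-- true ∷ p, which have no common extension; their up-sets are disjoint opens, so these two
-- words are not intertwined although both are intertwined with p. The same fork inside any
-- open T containing p violates transitivity of T, so there are no topens.
module Submission where

open import Defs
open import Data.Bool using (Bool; true; false)
open import Data.Empty using (⊥)
open import Data.List using (List; []; _∷_; _++_; length; replicate; reverse; _ʳ++_)
open import Data.List.Properties using (++-assoc; ++-cancelˡ; ∷-injectiveˡ; ++-ʳ++; ʳ++-defn; length-replicate)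
open import Data.Nat using (ℕ)
open import Data.Product using (Σ-syntax; ∃-syntax; ∃₂; _×_; _,_)
open import Data.Unit using (tt)
open import Function.Bundles using (_↣_; mk↣)
open import Relation.Nullary using (¬_)
open import Relation.Binary.PropositionalEquality
  using (_≡_; refl; sym; trans; cong; module ≡-Reasoning)

module _ {P : Set} (S : Semitopology P) where

  intertwined-sym : ∀ {p q} → Intertwined S p q → Intertwined S q p
  intertwined-sym p≬q O O' oO oO' O'q O'p with p≬q O' O oO' oO O'p O'q
  ... | x , O'x , Ox = x , Ox , O'x

module UpsetTopology {P : Set} (_≼_ : P → P → Set)
  (≼-refl : ∀ {p} → p ≼ p) (≼-trans : ∀ {p q r} → p ≼ q → q ≼ r → p ≼ r) where

  IsUpset : Subset P → Set
  IsUpset O = ∀ {p q} → p ≼ q → O p → O q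

  upsetSemitopology : Semitopology P
  upsetSemitopology = record
    { Open      = IsUpset
    ; open-∅    = λ _ ()
    ; open-full = λ _ _ → tt
    ; open-⋃    = λ I O up p≼q (i , Oᵢp) → i , up i p≼q Oᵢp
    }

  upset-isTopology : IsTopology upsetSemitopology
  upset-isTopology O O' up up' p≼q (Op , O'p) = up p≼q Op , up' p≼q O'p

  ↑ : P → Subset P
  ↑ p q = p ≼ q

  ↑-isUpset : ∀ p → IsUpset (↑ p)
  ↑-isUpset p q≼r p≼q = ≼-trans p≼q q≼r

  ≼⇒intertwined : ∀ {p q} → p ≼ q → Intertwined upsetSemitopology p q
  ≼⇒intertwined {q = q} p≼q O O' up up' Op O'q = q , up p≼q Op , O'q

  upset-weaklyRegular : ∀ p → WeaklyRegular upsetSemitopology p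
  upset-weaklyRegular p = ↑ p , ↑-isUpset p , ≼⇒intertwined , ≼-refl

  Incompatible : P → P → Set
  Incompatible a b = ∀ {c} → a ≼ c → b ≼ c → ⊥

  incompatible⇒¬intertwined : ∀ {a b} → Incompatible a b → ¬ Intertwined upsetSemitopology a b
  incompatible⇒¬intertwined a#b a≬b
    with a≬b (↑ _) (↑ _) (↑-isUpset _) (↑-isUpset _) ≼-refl ≼-refl
  ... | c , a≼c , b≼c = a#b a≼c b≼c

  Forks : P → Set
  Forks p = ∃₂ λ a b → p ≼ a × p ≼ b × Incompatible a b

  forks⇒conflicted : ∀ {p} → Forks p → Conflicted upsetSemitopology p
  forks⇒conflicted (a , b , p≼a , p≼b , a#b) =
    a , b , intertwined-sym upsetSemitopology (≼⇒intertwined p≼a) , ≼⇒intertwined p≼b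
      , incompatible⇒¬intertwined a#b

  forks⇒¬transitive : ∀ {p T} → IsUpset T → T p → Forks p
                    → ¬ Transitive upsetSemitopology T
  forks⇒¬transitive upT Tp (a , b , p≼a , p≼b , a#b) T-trans
    with T-trans (↑ a) (↑ b) (↑-isUpset a) (↑-isUpset b)
                 (a , ≼-refl , upT p≼a Tp) (b , upT p≼b Tp , ≼-refl)
  ... | c , a≼c , b≼c = a#b a≼c b≼c

  everywhere-forks⇒¬topen : (∀ p → Forks p) → ∀ T → ¬ Topen upsetSemitopology T
  everywhere-forks⇒¬topen forks T ((p , Tp) , upT , T-trans) =
    forks⇒¬transitive upT Tp (forks p) T-trans

module _ {A : Set} where

  _≼_ : List A → List A → Set
  u ≼ v = ∃[ w ] v ≡ w ++ u

  ≼-refl : ∀ {u} → u ≼ u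
  ≼-refl = [] , refl

  ≼-trans : ∀ {u v x} → u ≼ v → v ≼ x → u ≼ x
  ≼-trans {u} (w , refl) (w' , refl) = w' ++ w , sym (++-assoc w' w u)

  reverse-++-∷ : ∀ (w : List A) b p → reverse (w ++ b ∷ p) ≡ reverse p ++ b ∷ reverse w
  reverse-++-∷ w b p = begin
    (w ++ b ∷ p) ʳ++ []        ≡⟨ ++-ʳ++ w ⟩
    p ʳ++ b ∷ (w ʳ++ [])       ≡⟨ ʳ++-defn p ⟩
    reverse p ++ b ∷ reverse w ∎
    where open ≡-Reasoning

  ++-∷-injectiveˡ : ∀ w w' {b b' : A} p → w ++ b ∷ p ≡ w' ++ b' ∷ p → b ≡ b'
  ++-∷-injectiveˡ w w' {b} {b'} p eq = ∷-injectiveˡ (++-cancelˡ (reverse p) _ _ (begin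
    reverse p ++ b ∷ reverse w     ≡⟨ sym (reverse-++-∷ w b p) ⟩
    reverse (w ++ b ∷ p)           ≡⟨ cong reverse eq ⟩
    reverse (w' ++ b' ∷ p)         ≡⟨ reverse-++-∷ w' b' p ⟩
    reverse p ++ b' ∷ reverse w'   ∎))
    where open ≡-Reasoning

open UpsetTopology (_≼_ {Bool}) ≼-refl ≼-trans

binaryWords-fork : ∀ p → Forks p
binaryWords-fork p = false ∷ p , true ∷ p , (false ∷ [] , refl) , (true ∷ [] , refl) , incompatible
  where
  incompatible : Incompatible (false ∷ p) (true ∷ p)
  incompatible (w , refl) (w' , eq) with ++-∷-injectiveˡ w w' p eq
  ... | ()

replicate-injective : ∀ {m n} → replicate m true ≡ replicate n true → m ≡ n
replicate-injective {m} {n} eq =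
  trans (sym (length-replicate m)) (trans (cong length eq) (length-replicate n))

proposition6p22 : Σ[ P ∈ Set ] Σ[ S ∈ Semitopology P ]
    ( (ℕ ↣ P)
    × (∀ p → Quasiregular S p)
    × (∀ p → WeaklyRegular S p)
    × (∀ p → Conflicted S p)
    × IsTopology S
    × (∀ T → ¬ Topen S T) )
proposition6p22 =
  List Bool , upsetSemitopology
  , mk↣ replicate-injective
  , (λ p → p , upset-weaklyRegular p)
  , upset-weaklyRegular
  , (λ p → forks⇒conflicted (binaryWords-fork p))
  , upset-isTopology
  , everywhere-forks⇒¬topen binaryWords-fork
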